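{- Let $X$ be a permutation of $[n]$ avoiding $(2,3,1)$, $T$ an initial tree and $G(X)=G_T(X)$. Then there are no keys $a<b$ and times $t_1<t_2$ with $(a,t_2)\in BR$ and $(b,t_1)\in BR$. Therefore $|BR|=O(n)$.
   Context: $X=(x_1,\dots,x_n)$ is identified with the point set $\{(x_t,t)\}$. Geometric Greedy $G_T(X)$: the initial BST $T$ is encoded by a fixed point set in rows $-(n-1),\dots,0$ (standard geometric encoding); for $t=1,\dots,n$, with $p=(x_t,t)$ and, for each key $a$, $q=(a,\tau(a,t))$ where $\tau(a,t)$ is the last row $<t$ with a point in column $a$, add $(a,t)$ iff the closed rectangle with corners $p,q$ contains no other point; $G_T(X)$ is the set of points added in rows $1,\dots,n$. For $q\in G(X)\setminus X$ let $p_1\in X$ be the unique input point with $p_1.x=q.x$ and $p_2\in X$ the unique input point with $p_2.y=q.y$. $q$ is a bottom point ($q\in B$) if $p_1.y<q.y$ and a top point ($q\in T$) otherwise; $q\in R$ if $p_2.x>q.x$ (the input in its row lies to its right) and $q\in L$ if $p_2.x<q.x$. $BR=B\cap R$, $BL=B\cap L$, $TR=T\cap R$, $TL=T\cap L$. -}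

module Defs where

open import Data.Bool using (Bool; true; false; if_then_else_; _∧_; _∨_; not; T)
open import Data.Nat as ℕ using (ℕ; zero; suc; _<_; _≤_; _<ᵇ_; _≡ᵇ_)
open import Data.Integer as ℤ using (ℤ; +_; -[1+_]; -_)
open import Data.Product using (_×_; _,_; Σ; ∃)
open import Data.Maybe using (Maybe; just; nothing)
open import Data.List using (List; []; _∷_; _++_; map; concatMap; applyUpTo; length)
open import Data.List.Relation.Binary.Permutation.Propositional using (_↭_)
open import Data.List.Membership.Propositional using (_∈_)
open import Relation.Binary.PropositionalEquality using (_≡_)
open import Relation.Nullary using (¬_)

-- A point (key/column , row).
Point : Set
Point = ℕ × ℤ

keys : ℕ → List ℕ
keys n = applyUpTo suc n

data BT : Set where
  leaf : BT
  node : BT → ℕ → BT → BT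

inorder : BT → List ℕ
inorder leaf = []
inorder (node l k r) = inorder l ++ (k ∷ inorder r)

IsInitialTree : ℕ → BT → Set
IsInitialTree n t = inorder t ≡ keys n

depth : BT → ℕ → ℕ
depth leaf a = 0
depth (node l k r) a =
  if a <ᵇ k then suc (depth l a) else (if k <ᵇ a then suc (depth r a) else 0)

-- Standard geometric encoding: key a at row -depth(a) (rows -(n-1),…,0).
initPoints : ℕ → BT → List Point
initPoints n t = map (λ a → (a , - (+ depth t a))) (keys n)

lastRow : List Point → ℕ → Maybe ℤ
lastRow [] a = nothing
lastRow ((c , s) ∷ ps) a with lastRow ps a | c ≡ᵇ a
... | r       | false = r
... | nothing | true  = just s
... | just r  | true  = just (s ℤ.⊔ r)

ptEq : Point → Point → Bool
ptEq (c , s) (d , u) = (c ≡ᵇ d) ∧ ((s ℤ.≤ᵇ u) ∧ (u ℤ.≤ᵇ s))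

inRect : Point → Point → Point → Bool
inRect (px , py) (qx , qy) (rx , ry) =
  ((px ℕ.⊓ qx) ℕ.≤ᵇ rx) ∧ (rx ℕ.≤ᵇ (px ℕ.⊔ qx))
  ∧ (((py ℤ.⊓ qy) ℤ.≤ᵇ ry) ∧ (ry ℤ.≤ᵇ (py ℤ.⊔ qy)))

allB : {A : Set} → (A → Bool) → List A → Bool
allB f [] = true
allB f (x ∷ xs) = f x ∧ allB f xs

emptyRect : List Point → Point → Point → Bool
emptyRect pts p q = allB (λ r → not (inRect p q r) ∨ (ptEq r p ∨ ptEq r q)) (p ∷ pts)

addRow : ℕ → List Point → ℤ → ℕ → List Point
addRow n pts t x = concatMap step (keys n)
  where
  step : ℕ → List Point
  step a with lastRow pts a
  ... | nothing = []
  ... | just τ  = if emptyRect pts (x , t) (a , τ) then (a , t) ∷ [] else []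

-- process input rows t , t+1 , … ; returns only the newly added points
greedyRows : ℕ → List Point → ℕ → List ℕ → List Point
greedyRows n pts t [] = []
greedyRows n pts t (x ∷ xs) =
  addRow n pts (+ t) x ++ greedyRows n (addRow n pts (+ t) x ++ pts) (suc t) xs

G : ℕ → BT → List ℕ → List Point
G n t X = greedyRows n (initPoints n t) 1 X

-- 1-indexed access: nth X t = x_t
nth : List ℕ → ℕ → Maybe ℕ
nth [] t = nothing
nth (x ∷ xs) zero = nothing
nth (x ∷ xs) (suc zero) = just x
nth (x ∷ xs) (suc (suc t)) = nth xs (suc t)

-- 1-indexed position (time) of key a in X
pos : List ℕ → ℕ → Maybe ℕ
pos [] a = nothing
pos (x ∷ xs) a = if x ≡ᵇ a then just 1 else go (pos xs a)
  where
  go : Maybe ℕ → Maybe ℕ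
  go nothing = nothing
  go (just k) = just (suc k)

IsPermOf : ℕ → List ℕ → Set
IsPermOf n X = X ↭ keys n

Avoids231 : List ℕ → Set
Avoids231 X = ∀ i j k xi xj xk → i < j → j < k →
  nth X i ≡ just xi → nth X j ≡ just xj → nth X k ≡ just xk →
  ¬ (xk < xi × xi < xj)

-- for a point q=(a,t) not in X: B means the input in column a (time pos a)
-- is strictly below row t; R means the input x_t of row t is right of a
-- (x_t > a, which also gives q ∉ X).
brCond : List ℕ → Point → Bool
brCond X (a , -[1+ _ ]) = false
brCond X (a , + t) with nth X t | pos X a
... | just xt | just s = (a <ᵇ xt) ∧ (s <ᵇ t)
... | _       | _      = false

InBR : ℕ → BT → List ℕ → ℕ → ℕ → Set
InBR n tr X a t = ((a , + t) ∈ G n tr X) × T (brCond X (a , + t))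

boolFilter : {A : Set} → (A → Bool) → List A → List A
boolFilter f [] = []
boolFilter f (x ∷ xs) = if f x then x ∷ boolFilter f xs else boolFilter f xs

brCount : ℕ → BT → List ℕ → ℕ
brCount n tr X = length (boolFilter (brCond X) (G n tr X))

-- Let (b , t₁) ∈ BR: the input b came at a time s < t₁, and the input y of row t₁ satisfies y > b.
-- Suppose G(X) has a point (a , u) with a < b and u > t₁, and let x be the input of row u.
-- If x < b then x_s = b, x_t₁ = y, x_u = x is a 231 pattern. Otherwise column b holds a point
-- (b , τ′) with t₁ ≤ τ′ < u, and greedy added (a , u) because the rectangle spanned by (x , u)
-- and the topmost earlier point (a , τ) of column a is empty; as (b , τ′) is not in it, τ > τ′ ≥ t₁.
-- So (a , τ) is a lower point of G(X) of the same kind, and infinite descent excludes (a , u).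
-- Hence, along the BR points in the order greedy emits them, keys increase within a row and do
-- not decrease from row to row, so key + row strictly increases. It lies in [1 , 2n], so |BR| ≤ 2n.
module Submission where

open import Defs
open import Data.Nat using (ℕ; _<_; _≤_; _*_)
open import Data.List using (List)
open import Data.Product using (_×_; Σ; ∃; _,_)
open import Relation.Nullary using (¬_)

open import Data.Bool using (Bool; true; false; not; _∧_; T)
open import Data.Bool.Properties using (T-∧; T-∨; T-not-≡; T-≡)
open import Data.Empty using (⊥-elim)
open import Data.Integer as ℤ using (ℤ; +_)
import Data.Integer.Properties as ℤₚ
open import Data.List using ([]; _∷_; _++_; length; concatMap; map; filterᵇ)
open import Data.List.Properties using (length-map; length-applyUpTo)
open import Data.List.Membership.Propositional using (_∈_; find)
open import Data.List.Membership.Propositional.Properties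
  using (∈-++⁻; ∈-++⁺ˡ; ∈-++⁺ʳ; ∈-map⁻; ∈-concatMap⁻; ∈-applyUpTo⁻; ∈-filter⁻)
open import Data.List.Relation.Binary.Permutation.Propositional.Properties using (↭-length)
open import Data.List.Relation.Unary.All as All using (All; []; _∷_)
import Data.List.Relation.Unary.All.Properties as Allₚ
open import Data.List.Relation.Unary.AllPairs as AllPairs using (AllPairs; []; _∷_)
import Data.List.Relation.Unary.AllPairs.Properties as AllPairsₚ
open import Data.List.Relation.Unary.Any using (here; there)
open import Data.Maybe using (just; nothing)
open import Data.Nat using (suc; _+_; z≤n; s≤s; _<?_; _≡ᵇ_; _<ᵇ_)
open import Data.Nat.Induction using (<-wellFounded)
import Data.Nat.Properties as ℕₚ
open import Data.Product using (proj₁; proj₂)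
open import Data.Sum as Sum using (_⊎_; inj₁; inj₂)
open import Function using (_⇔_; mk⇔; Equivalence; _∘_)
open import Induction.WellFounded using (Acc; acc)
open import Relation.Binary.PropositionalEquality using (_≡_; refl; sym; trans; cong; cong₂; subst)
open import Relation.Nullary using (yes; no)
open import Relation.Nullary.Decidable using (T?)

AllPairs-map-All : ∀ {A : Set} {P : A → Set} {R R′ : A → A → Set} {xs} →
  (∀ {x y} → P x → P y → R x y → R′ x y) → All P xs → AllPairs R xs → AllPairs R′ xs
AllPairs-map-All f [] [] = []
AllPairs-map-All f (px ∷ pxs) (Rx ∷ Rxs) =
  All.zipWith (λ where (py , r) → f px py r) (pxs , Rx) ∷ AllPairs-map-All f pxs Rxs

strictlyIncreasing-length : ∀ {lo hi xs} → lo ≤ hi → AllPairs _<_ xs → All (lo ≤_) xs → All (_< hi) xs →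
  lo + length xs ≤ hi
strictlyIncreasing-length {lo} lo≤hi [] [] [] = subst (_≤ _) (sym (ℕₚ.+-identityʳ lo)) lo≤hi
strictlyIncreasing-length {lo} {hi} {x ∷ xs} _ (x<xs ∷ xs↑) (lo≤x ∷ _) (x<hi ∷ xs<hi) = begin
  lo + suc (length xs) ≡⟨ ℕₚ.+-suc lo (length xs) ⟩
  suc (lo + length xs) ≤⟨ s≤s (ℕₚ.+-monoˡ-≤ (length xs) lo≤x) ⟩
  suc x + length xs    ≤⟨ strictlyIncreasing-length x<hi xs↑ x<xs xs<hi ⟩
  hi                   ∎
  where open ℕₚ.≤-Reasoning

boolFilter≡filterᵇ : ∀ {A : Set} (f : A → Bool) xs → boolFilter f xs ≡ filterᵇ f xs
boolFilter≡filterᵇ f [] = refl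
boolFilter≡filterᵇ f (x ∷ xs) with f x
... | true  = cong (x ∷_) (boolFilter≡filterᵇ f xs)
... | false = boolFilter≡filterᵇ f xs

allB-∈ : ∀ {A : Set} (f : A → Bool) {xs x} → T (allB f xs) → x ∈ xs → T (f x)
allB-∈ f {y ∷ _} all (here refl) = proj₁ (Equivalence.to (T-∧ {f y}) all)
allB-∈ f {y ∷ _} all (there x∈) = allB-∈ f (proj₂ (Equivalence.to (T-∧ {f y}) all)) x∈

T-∧⁺ : ∀ {x y} → T x → T y → T (x ∧ y)
T-∧⁺ tx ty = Equivalence.from T-∧ (tx , ty)

+<⇒≡+ : ∀ {m τ} → + m ℤ.< τ → ∃ λ v → τ ≡ + v × m < v
+<⇒≡+ {τ = + v} m<v = v , refl , ℤₚ.drop‿+<+ m<v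

key : Point → ℕ
key = proj₁

row : Point → ℤ
row = proj₂

ptEq-sound : ∀ r p → T (ptEq r p) → r ≡ p
ptEq-sound (c , s) (d , u) r≐p
  with c≡d , s≤u∧u≤s ← Equivalence.to (T-∧ {c ≡ᵇ d}) r≐p
  with s≤u , u≤s ← Equivalence.to (T-∧ {s ℤ.≤ᵇ u}) s≤u∧u≤s
  = cong₂ _,_ (ℕₚ.≡ᵇ⇒≡ c d c≡d) (ℤₚ.≤-antisym (ℤₚ.≤ᵇ⇒≤ s≤u) (ℤₚ.≤ᵇ⇒≤ u≤s))

inRect-intro : ∀ {x a b : ℕ} {u τ τ′ : ℤ} → a ≤ b → b ≤ x → τ ℤ.≤ τ′ → τ′ ℤ.≤ u →
  T (inRect (x , u) (a , τ) (b , τ′))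
inRect-intro {x} {a} {u = u} {τ} a≤b b≤x τ≤τ′ τ′≤u =
  T-∧⁺ (ℕₚ.≤⇒≤ᵇ (ℕₚ.≤-trans (ℕₚ.m⊓n≤n x a) a≤b))
  (T-∧⁺ (ℕₚ.≤⇒≤ᵇ (ℕₚ.≤-trans b≤x (ℕₚ.m≤m⊔n x a)))
  (T-∧⁺ (ℤₚ.≤⇒≤ᵇ (ℤₚ.≤-trans (ℤₚ.i⊓j≤j u τ) τ≤τ′)) (ℤₚ.≤⇒≤ᵇ (ℤₚ.≤-trans τ′≤u (ℤₚ.i≤i⊔j u τ)))))

emptyRect-sound : ∀ {S p q r} → T (emptyRect S p q) → r ∈ S → T (inRect p q r) → r ≡ p ⊎ r ≡ q
emptyRect-sound {S} {p} {q} {r} empty r∈S r∈pq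
  with Equivalence.to (T-∨ {not (inRect p q r)}) (allB-∈ _ empty (there r∈S))
... | inj₁ r∉pq = ⊥-elim (subst T (Equivalence.to T-not-≡ r∉pq) r∈pq)
... | inj₂ r≐p∨q with Equivalence.to (T-∨ {ptEq r p}) r≐p∨q
...   | inj₁ r≐p = inj₁ (ptEq-sound r p r≐p)
...   | inj₂ r≐q = inj₂ (ptEq-sound r q r≐q)

lastRow-∈ : ∀ S c {τ} → lastRow S c ≡ just τ → (c , τ) ∈ S
lastRow-∈ ((d , s) ∷ S) c eq with lastRow S c in last | d ≡ᵇ c in d≟c
... | _       | false = there (lastRow-∈ S c (trans last eq))
... | nothing | true with refl ← eq | refl ← ℕₚ.≡ᵇ⇒≡ d c (Equivalence.from T-≡ d≟c) = here refl
... | just r  | true with refl ← eq | refl ← ℕₚ.≡ᵇ⇒≡ d c (Equivalence.from T-≡ d≟c) with ℤₚ.⊔-sel s r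
...   | inj₁ s⊔r≡s rewrite s⊔r≡s = here refl
...   | inj₂ s⊔r≡r rewrite s⊔r≡r = there (lastRow-∈ S c last)

lastRow-≥ : ∀ S c {s} → (c , s) ∈ S → ∃ λ τ → lastRow S c ≡ just τ × s ℤ.≤ τ
lastRow-≥ ((d , u) ∷ S) c c,s∈ with lastRow S c in last | d ≡ᵇ c in d≟c | c,s∈
... | _       | false | here refl = ⊥-elim (subst T d≟c (ℕₚ.≡⇒≡ᵇ d d refl))
... | _       | false | there c,s∈S with τ , eq , s≤τ ← lastRow-≥ S c c,s∈S = τ , trans (sym last) eq , s≤τ
... | nothing | true  | here refl = u , refl , ℤₚ.≤-refl
... | nothing | true  | there c,s∈S with _ , eq , _ ← lastRow-≥ S c c,s∈S with () ← trans (sym last) eq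
... | just r  | true  | here refl = u ℤ.⊔ r , refl , ℤₚ.i≤i⊔j u r
... | just r  | true  | there c,s∈S with τ , eq , s≤τ ← lastRow-≥ S c c,s∈S with refl ← trans (sym last) eq =
  u ℤ.⊔ r , refl , ℤₚ.≤-trans s≤τ (ℤₚ.i≤j⊔i u r)

module _ {t : ℤ} {step : ℕ → List Point} (step-shape : ∀ a → step a ≡ [] ⊎ step a ≡ (a , t) ∷ []) where

  concatMap-cells-All : ∀ {P : Point → Set} {ks} → All (λ a → P (a , t)) ks → All P (concatMap step ks)
  concatMap-cells-All [] = []
  concatMap-cells-All {ks = k ∷ _} (pk ∷ pks) with step-shape k
  ... | inj₁ eq rewrite eq = concatMap-cells-All pks
  ... | inj₂ eq rewrite eq = pk ∷ concatMap-cells-All pks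

  concatMap-cells-AllPairs : ∀ {R : Point → Point → Set} {ks} → (∀ {a b} → a < b → R (a , t) (b , t)) →
    AllPairs _<_ ks → AllPairs R (concatMap step ks)
  concatMap-cells-AllPairs R-intro [] = []
  concatMap-cells-AllPairs {ks = k ∷ _} R-intro (k<ks ∷ ks↑) with step-shape k
  ... | inj₁ eq rewrite eq = concatMap-cells-AllPairs R-intro ks↑
  ... | inj₂ eq rewrite eq = concatMap-cells-All (All.map R-intro k<ks) ∷ concatMap-cells-AllPairs R-intro ks↑

keys-increasing : ∀ n → AllPairs _<_ (keys n)
keys-increasing n = AllPairsₚ.applyUpTo⁺₁ suc n (λ i<j _ → s≤s i<j)

Added : List Point → ℤ → ℕ → ℕ → Set
Added S t x a = ∃ λ τ → lastRow S a ≡ just τ × T (emptyRect S (x , t) (a , τ))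

-- The local function `step` of addRow cannot be named; this makes it available (by refl)
-- so that its two possible shapes can be analysed.
addRow-concatMap : ∀ n S t x → ∃ λ (step : ℕ → List Point) → addRow n S t x ≡ concatMap step (keys n)
addRow-concatMap n S t x = _ , refl

addRow-step : ∀ n S t x a → let step = proj₁ (addRow-concatMap n S t x) in
  step a ≡ [] ⊎ (step a ≡ (a , t) ∷ [] × Added S t x a)
addRow-step n S t x a with lastRow S a
... | nothing = inj₁ refl
... | just τ with emptyRect S (x , t) (a , τ) in empty
...   | true  = inj₂ (refl , τ , refl , Equivalence.from T-≡ empty)
...   | false = inj₁ refl

∈-addRow⁻ : ∀ n S t x {r} → r ∈ addRow n S t x → ∃ λ a → a ∈ keys n × r ≡ (a , t) × Added S t x a
∈-addRow⁻ n S t x r∈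
  with a , a∈ , r∈step ← find (∈-concatMap⁻ (proj₁ (addRow-concatMap n S t x)) r∈)
  with addRow-step n S t x a
... | inj₁ eq rewrite eq with () ← r∈step
... | inj₂ (eq , added) rewrite eq with here refl ← r∈step = a , a∈ , refl , added

addRow-increasing : ∀ n S t x → AllPairs (λ p q → row p ≡ row q × key p < key q) (addRow n S t x)
addRow-increasing n S t x =
  concatMap-cells-AllPairs (λ a → Sum.map₂ proj₁ (addRow-step n S t x a)) (λ a<b → refl , a<b) (keys-increasing n)

∈-greedyRows-row : ∀ n S t xs {r} → r ∈ greedyRows n S t xs → ∃ λ u → row r ≡ + u × t ≤ u × u < t + length xs
∈-greedyRows-row n S t (y ∷ ys) r∈ with ∈-++⁻ (addRow n S (+ t) y) r∈
... | inj₁ r∈row with _ , _ , refl , _ ← ∈-addRow⁻ n S (+ t) y r∈row =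
  t , refl , ℕₚ.≤-refl , ℕₚ.m<m+n t (s≤s z≤n)
... | inj₂ r∈later with u , eq , t<u , u<end ← ∈-greedyRows-row n _ (suc t) ys r∈later =
  u , eq , ℕₚ.<⇒≤ t<u , subst (u <_) (sym (ℕₚ.+-suc t (length ys))) u<end

∈-greedyRows-key : ∀ n S t xs {r} → r ∈ greedyRows n S t xs → key r ≤ n
∈-greedyRows-key n S t (y ∷ ys) r∈ with ∈-++⁻ (addRow n S (+ t) y) r∈
... | inj₂ r∈later = ∈-greedyRows-key n _ (suc t) ys r∈later
... | inj₁ r∈row with _ , a∈ , refl , _ ← ∈-addRow⁻ n S (+ t) y r∈row
                 with _ , i<n , refl ← ∈-applyUpTo⁻ suc a∈ = i<n

_≺_ : Point → Point → Set
p ≺ q = row p ℤ.< row q ⊎ (row p ≡ row q × key p < key q)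

greedyRows-≺ : ∀ n S t xs → AllPairs _≺_ (greedyRows n S t xs)
greedyRows-≺ n S t [] = []
greedyRows-≺ n S t (y ∷ ys) =
  AllPairsₚ.++⁺ (AllPairs.map inj₂ (addRow-increasing n S (+ t) y)) (greedyRows-≺ n _ (suc t) ys)
    (All.tabulate λ p∈ → All.tabulate λ q∈ → inj₁ (row-t-below p∈ q∈))
  where
  row-t-below : ∀ {p q} → p ∈ addRow n S (+ t) y → q ∈ greedyRows n _ (suc t) ys → row p ℤ.< row q
  row-t-below p∈ q∈ with _ , _ , refl , _ ← ∈-addRow⁻ n S (+ t) y p∈
                    with _ , refl , t<u , _ ← ∈-greedyRows-row n _ (suc t) ys q∈ = ℤ.+<+ t<u

-- The points greedy knows when it processes row u: those of S and those of out below row u.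
Snapshot : List Point → List Point → ℤ → List Point → Set
Snapshot S out u S′ = ∀ r → r ∈ S′ ⇔ (r ∈ S ⊎ (r ∈ out × row r ℤ.< u))

snapshot-first : ∀ {S out u} → (∀ {r} → r ∈ out → ¬ row r ℤ.< u) → Snapshot S out u S
snapshot-first out-late r = mk⇔ inj₁ λ where
  (inj₁ r∈S) → r∈S
  (inj₂ (r∈out , early)) → ⊥-elim (out-late r∈out early)

snapshot-shift : ∀ {S A later u S′} → (∀ {r} → r ∈ A → row r ℤ.< u) →
  Snapshot (A ++ S) later u S′ → Snapshot S (A ++ later) u S′
snapshot-shift {S} {A} {later} {u} {S′} A-early snap r = mk⇔ to from
  where
  to : r ∈ S′ → r ∈ S ⊎ (r ∈ A ++ later × row r ℤ.< u)
  to r∈S′ with Equivalence.to (snap r) r∈S′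
  ... | inj₁ r∈A++S with ∈-++⁻ A r∈A++S
  ...   | inj₁ r∈A = inj₂ (∈-++⁺ˡ r∈A , A-early r∈A)
  ...   | inj₂ r∈S = inj₁ r∈S
  to _ | inj₂ (r∈later , early) = inj₂ (∈-++⁺ʳ A r∈later , early)
  from : r ∈ S ⊎ (r ∈ A ++ later × row r ℤ.< u) → r ∈ S′
  from (inj₁ r∈S) = Equivalence.from (snap r) (inj₁ (∈-++⁺ʳ A r∈S))
  from (inj₂ (r∈A++later , early)) with ∈-++⁻ A r∈A++later
  ... | inj₁ r∈A = Equivalence.from (snap r) (inj₁ (∈-++⁺ˡ r∈A))
  ... | inj₂ r∈later = Equivalence.from (snap r) (inj₂ (r∈later , early))

greedyRows-snapshot : ∀ n S t xs {a u} → (a , + u) ∈ greedyRows n S t xs →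
  ∃ λ S′ → ∃ λ x → ∃ λ i → u ≡ t + i × nth xs (suc i) ≡ just x ×
    (a , + u) ∈ addRow n S′ (+ u) x × Snapshot S (greedyRows n S t xs) (+ u) S′
greedyRows-snapshot n S t (y ∷ ys) a,u∈ with ∈-++⁻ (addRow n S (+ t) y) a,u∈
... | inj₁ a,u∈row with _ , _ , refl , _ ← ∈-addRow⁻ n S (+ t) y a,u∈row =
  S , y , 0 , sym (ℕₚ.+-identityʳ t) , refl , a,u∈row , snapshot-first not-below-t
  where
  not-below-t : ∀ {r} → r ∈ greedyRows n S t (y ∷ ys) → ¬ row r ℤ.< + t
  not-below-t r∈ early with _ , refl , t≤v , _ ← ∈-greedyRows-row n S t (y ∷ ys) r∈ =
    ℕₚ.<⇒≱ (ℤₚ.drop‿+<+ early) t≤v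
... | inj₂ a,u∈later
  with S′ , x , i , refl , xᵢ , a,u∈row , snap ← greedyRows-snapshot n _ (suc t) ys a,u∈later =
  S′ , x , suc i , sym (ℕₚ.+-suc t i) , xᵢ , a,u∈row , snapshot-shift row-t-early snap
  where
  row-t-early : ∀ {r} → r ∈ addRow n S (+ t) y → row r ℤ.< + (suc t + i)
  row-t-early r∈ with _ , _ , refl , _ ← ∈-addRow⁻ n S (+ t) y r∈ = ℤ.+<+ (s≤s (ℕₚ.m≤m+n t i))

initPoints-nonpositive : ∀ n T {r} → r ∈ initPoints n T → row r ℤ.≤ + 0
initPoints-nonpositive n T r∈ with _ , _ , refl ← ∈-map⁻ _ r∈ = ℤₚ.neg-≤-pos

nth-∷ : ∀ {x : ℕ} xs {k b} → nth xs k ≡ just b → nth (x ∷ xs) (suc k) ≡ just b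
nth-∷ (_ ∷ _) {suc _} eq = eq

pos-nth : ∀ X {b s} → pos X b ≡ just s → nth X s ≡ just b
pos-nth (x ∷ xs) {b} eq with x ≡ᵇ b in x≟b
... | true with refl ← eq with refl ← ℕₚ.≡ᵇ⇒≡ x b (Equivalence.from T-≡ x≟b) = refl
... | false with pos xs b in found
...   | just k with refl ← eq = nth-∷ xs (pos-nth xs found)

brCond-sound : ∀ X b t → T (brCond X (b , + t)) →
  ∃ λ y → ∃ λ s → nth X t ≡ just y × nth X s ≡ just b × b < y × s < t
brCond-sound X b t br with nth X t | pos X b in found
... | just y | just s with b<y , s<t ← Equivalence.to (T-∧ {b <ᵇ y}) br =
  y , s , refl , pos-nth X found , ℕₚ.<ᵇ⇒< b y b<y , ℕₚ.<ᵇ⇒< s t s<t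

IsPermOf-length : ∀ {n X} → IsPermOf n X → length X ≡ n
IsPermOf-length {n} perm = trans (↭-length perm) (length-applyUpTo suc n)

-- Rows of greedy points are positive, so ∣ row p ∣ is the row itself.
weight : Point → ℕ
weight p = key p + ℤ.∣ row p ∣

module GreedyRun (n : ℕ) (Tr : BT) (X : List ℕ) where

  GX : List Point
  GX = G n Tr X

  G-point-origin : ∀ {a u} → (a , + u) ∈ GX → ∃ λ S′ → ∃ λ x → 1 ≤ u × nth X u ≡ just x ×
    (a , + u) ∈ addRow n S′ (+ u) x × Snapshot (initPoints n Tr) GX (+ u) S′
  G-point-origin a,u∈ with S′ , x , _ , refl , xᵤ , a,u∈row , snap ← greedyRows-snapshot n _ 1 X a,u∈ =
    S′ , x , s≤s z≤n , xᵤ , a,u∈row , snap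

  module _ {u S′} (1≤u : 1 ≤ u) (snap : Snapshot (initPoints n Tr) GX (+ u) S′) where

    snapshot-early : ∀ {r} → r ∈ S′ → row r ℤ.< + u
    snapshot-early r∈ with Equivalence.to (snap _) r∈
    ... | inj₁ r∈init = ℤₚ.≤-<-trans (initPoints-nonpositive n Tr r∈init) (ℤ.+<+ 1≤u)
    ... | inj₂ (_ , early) = early

    snapshot-⊆G : ∀ {a v} → (a , + v) ∈ S′ → 1 ≤ v → (a , + v) ∈ GX
    snapshot-⊆G a,v∈ 1≤v with Equivalence.to (snap _) a,v∈
    ... | inj₁ a,v∈init = ⊥-elim (ℕₚ.<⇒≱ 1≤v (ℤₚ.drop‿+≤+ (initPoints-nonpositive n Tr a,v∈init)))
    ... | inj₂ (a,v∈G , _) = a,v∈G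

    snapshot-⊇G : ∀ {r} → r ∈ GX → row r ℤ.< + u → r ∈ S′
    snapshot-⊇G r∈ early = Equivalence.from (snap _) (inj₂ (r∈ , early))

  module _ (avoids : Avoids231 X) {b t₁} (b,t₁∈ : (b , + t₁) ∈ GX) (br : T (brCond X (b , + t₁))) where

    descend : ∀ {a u} → a < b → t₁ < u → (a , + u) ∈ GX → ∃ λ v → t₁ < v × v < u × (a , + v) ∈ GX
    descend {a} {u} a<b t₁<u a,u∈
      with y , s , yₜ , bₛ , b<y , s<t₁ ← brCond-sound X b t₁ br
      with S′ , x , 1≤u , xᵤ , a,u∈row , snap ← G-point-origin a,u∈
      with _ , _ , refl , τ , lastA , empty ← ∈-addRow⁻ n S′ (+ u) x a,u∈row
      with x <? b
    ... | yes x<b = ⊥-elim (avoids s t₁ u b y x s<t₁ t₁<u bₛ yₜ xᵤ (x<b , b<y))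
    ... | no x≮b
      with τ′ , lastB , t₁≤τ′ ← lastRow-≥ S′ b (snapshot-⊇G 1≤u snap b,t₁∈ (ℤ.+<+ t₁<u))
      with b,τ′∈S′ ← lastRow-∈ S′ b lastB
      with τ′ ℤ.<? τ
    ... | yes τ′<τ with v , refl , t₁<v ← +<⇒≡+ (ℤₚ.≤-<-trans t₁≤τ′ τ′<τ)
                   with a,v∈S′ ← lastRow-∈ S′ a lastA =
      v , t₁<v , ℤₚ.drop‿+<+ (snapshot-early 1≤u snap a,v∈S′) ,
      snapshot-⊆G 1≤u snap a,v∈S′ (ℕₚ.≤-trans (s≤s z≤n) t₁<v)
    ... | no τ′≮τ
      with emptyRect-sound {S′} {x , + u} {a , τ} empty b,τ′∈S′
             (inRect-intro (ℕₚ.<⇒≤ a<b) (ℕₚ.≮⇒≥ x≮b) (ℤₚ.≮⇒≥ τ′≮τ) (ℤₚ.<⇒≤ (snapshot-early 1≤u snap b,τ′∈S′)))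
    ... | inj₁ refl = ⊥-elim (ℤₚ.<-irrefl refl (snapshot-early 1≤u snap b,τ′∈S′))
    ... | inj₂ refl = ⊥-elim (ℕₚ.<-irrefl refl a<b)

    no-point-left-above : ∀ {a u} → a < b → t₁ < u → ¬ (a , + u) ∈ GX
    no-point-left-above {a} a<b = go (<-wellFounded _)
      where
      go : ∀ {u} → Acc _<_ u → t₁ < u → ¬ (a , + u) ∈ GX
      go (acc below) t₁<u a,u∈ with v , t₁<v , v<u , a,v∈ ← descend a<b t₁<u a,u∈ = go (below v<u) t₁<v a,v∈

  BR-weight-increasing : Avoids231 X → ∀ {p q} → p ∈ GX → T (brCond X p) → q ∈ GX → p ≺ q →
    weight p < weight q
  BR-weight-increasing avoids {b , _} {a , _} p∈ br q∈ p≺q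
    with u , refl , _ ← ∈-greedyRows-row n _ 1 X p∈
       | v , refl , _ ← ∈-greedyRows-row n _ 1 X q∈
    with p≺q
  ... | inj₁ u<v = ℕₚ.+-mono-≤-< b≤a (ℤₚ.drop‿+<+ u<v)
    where
    b≤a : b ≤ a
    b≤a = ℕₚ.≮⇒≥ λ a<b → no-point-left-above avoids p∈ br a<b (ℤₚ.drop‿+<+ u<v) q∈
  ... | inj₂ (refl , b<a) = ℕₚ.+-monoˡ-< u b<a

  G-weight-bounds : length X ≡ n → ∀ {p} → p ∈ GX → 1 ≤ weight p × weight p < suc (2 * n)
  G-weight-bounds |X|≡n {a , _} p∈ with u , refl , 1≤u , u<1+|X| ← ∈-greedyRows-row n _ 1 X p∈ =
    ℕₚ.≤-trans 1≤u (ℕₚ.m≤n+m u a) , s≤s (begin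
      a + u ≤⟨ ℕₚ.+-mono-≤ (∈-greedyRows-key n _ 1 X p∈) (ℕₚ.≤-pred (subst (u <_) (cong suc |X|≡n) u<1+|X|)) ⟩
      n + n ≡⟨ cong (_+_ n) (sym (ℕₚ.+-identityʳ n)) ⟩
      2 * n ∎)
    where open ℕₚ.≤-Reasoning

  brCount-≤ : Avoids231 X → length X ≡ n → brCount n Tr X ≤ 2 * n
  brCount-≤ avoids |X|≡n = begin
    brCount n Tr X         ≡⟨ cong length (boolFilter≡filterᵇ (brCond X) GX) ⟩
    length BR              ≡⟨ length-map weight BR ⟨
    length (map weight BR) ≤⟨ ℕₚ.≤-pred (strictlyIncreasing-length (s≤s z≤n) weights↑
                                (Allₚ.map⁺ (All.map (proj₁ ∘ bounds) BR∈))
                                (Allₚ.map⁺ (All.map (proj₂ ∘ bounds) BR∈))) ⟩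
    2 * n                  ∎
    where
    open ℕₚ.≤-Reasoning
    BR : List Point
    BR = filterᵇ (brCond X) GX
    BR∈ : All (λ p → p ∈ GX × T (brCond X p)) BR
    BR∈ = All.tabulate (∈-filter⁻ (T? ∘ brCond X))
    bounds : ∀ {p} → p ∈ GX × T (brCond X p) → 1 ≤ weight p × weight p < suc (2 * n)
    bounds (p∈ , _) = G-weight-bounds |X|≡n p∈
    weights↑ : AllPairs _<_ (map weight BR)
    weights↑ = AllPairsₚ.map⁺ (AllPairs-map-All
      (λ (p∈ , br) (q∈ , _) → BR-weight-increasing avoids p∈ br q∈)
      BR∈ (AllPairsₚ.filter⁺ (T? ∘ brCond X) (greedyRows-≺ n _ 1 X)))

mainTheorem16 :
    ((n : ℕ) (X : List ℕ) (T : BT) →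
      IsPermOf n X → Avoids231 X → IsInitialTree n T →
      ¬ (Σ ℕ λ a → Σ ℕ λ b → Σ ℕ λ t₁ → Σ ℕ λ t₂ →
           a < b × t₁ < t₂ × InBR n T X a t₂ × InBR n T X b t₁))
    ×
    (Σ ℕ λ c → Σ ℕ λ n₀ → (n : ℕ) (X : List ℕ) (T : BT) → n₀ ≤ n →
      IsPermOf n X → Avoids231 X → IsInitialTree n T →
      brCount n T X ≤ c * n)
mainTheorem16 =
  (λ where n X T _ avoids _ (_ , _ , _ , _ , a<b , t₁<t₂ , (a,t₂∈ , _) , (b,t₁∈ , br)) →
             GreedyRun.no-point-left-above n T X avoids b,t₁∈ br a<b t₁<t₂ a,t₂∈)
  , 2 , 0 , λ n X T _ perm avoids _ → GreedyRun.brCount-≤ n T X avoids (IsPermOf-length perm)
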